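{- Let $i$ be an index such that for every $x$ the limit $\lim_k\lim_s A_i(x,k,s)$ exists, and let $A_i$ be the set whose characteristic function is this limit. If $A_i$ is infinite and has weak apartness, then there exists a finite set $C_i$ with $|C_i|=2^i$ such that $\lim_k\lim_s C_i(k,s)=C_i$ (i.e. there is $K$ such that for every $k>K$ there is $s_k$ with $C_i(k,s)=C_i$ for all $s>s_k$).
   Context: For $x=\sum_{j=0}^{m}2^{n_j}\in\mathbb{Z}^+$ with $n_0<\dots<n_m$, $\mu(x)=n_m$, $\lambda(x)=n_0$; $B^n=\{x\in\mathbb{Z}^+:\mu(x)=n\}$. A set $A\subseteq\mathbb{Z}^+$ has weak apartness if for every $m$, $|B^m\cap A|\leq 1$, and for every $l$, at most two $x\in A$ have $\lambda(x)=l$. Let $\Phi_j$ denote the $j$-th oracle Turing functional and $\emptyset'[s]$ the stage-$s$ approximation to the halting set; define the total recursive $\{0,1\}$-valued functions $A_j(x,k,s)=\Phi_j^{\emptyset'[s]}(x,k)[s]$ if this converges in $s$ steps with value in $\{0,1\}$, and $A_j(x,k,s)=0$ otherwise. Let $a_i(n,k,s)=\max\{A_i(x,k,s):x\in B^n\}$, and let $C_i(k,s)$ be the set of the first $2^i$ numbers $n$ with $i<n<s$ and $a_i(n,k,s)=1$ (or all such $n$ if there are fewer than $2^i$). -}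

module Defs where

open import Data.Nat using (ℕ; zero; suc; _+_; _*_; _∸_; _^_; _≤_; _<_)
open import Data.Nat.Divisibility using (_∣_)
open import Data.Bool using (Bool; true; false)
open import Data.List using (List; []; _∷_; map; upTo; filter; take)
open import Data.Bool.ListAction using (any)
open import Data.Product using (Σ; ∃; _×_; _,_)
open import Data.Sum using (_⊎_)
open import Relation.Nullary using (¬_)
open import Relation.Binary.PropositionalEquality using (_≡_)
open import Data.Bool.Properties using (T?)

-- A "total recursive {0,1}-valued" approximating function, modelled as a
-- Bool-valued function of (x, k, s)  (true = 1, false = 0).
Approx : Set
Approx = ℕ → ℕ → ℕ → Bool

InB : ℕ → ℕ → Set
InB n x = 2 ^ n ≤ x × x < 2 ^ suc n

LowBit : ℕ → ℕ → Set
LowBit l x = 1 ≤ x × (2 ^ l ∣ x) × ¬ (2 ^ suc l ∣ x)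

Bset : ℕ → List ℕ
Bset n = map (2 ^ n +_) (upTo (2 ^ n))

aFun : Approx → ℕ → ℕ → ℕ → Bool
aFun A n k s = any (λ x → A x k s) (Bset n)

between : ℕ → ℕ → List ℕ
between i s = map (suc i +_) (upTo (s ∸ suc i))

-- C_i(k,s): the first 2^i numbers n with i < n < s and a(n,k,s) = 1
-- (all of them if there are fewer), in increasing order
Cfun : ℕ → Approx → ℕ → ℕ → List ℕ
Cfun i A k s = take (2 ^ i) (filter (λ n → T? (aFun A n k s)) (between i s))

LimLim : {X : Set} → (ℕ → ℕ → X) → X → Set
LimLim f v = Σ ℕ λ K → (k : ℕ) → K < k → Σ ℕ λ sk → (s : ℕ) → sk < s → f k s ≡ v

-- a set A ⊆ ℤ⁺ given by a characteristic function χ (only positive x matter)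
Infinite : (ℕ → Bool) → Set
Infinite χ = (N : ℕ) → Σ ℕ λ x → N < x × χ x ≡ true

WeakApart : (ℕ → Bool) → Set
WeakApart χ =
  ((m x y : ℕ) → χ x ≡ true → χ y ≡ true → InB m x → InB m y → x ≡ y)
  × ((l x y z : ℕ) → χ x ≡ true → χ y ≡ true → χ z ≡ true →
       LowBit l x → LowBit l y → LowBit l z →
       (x ≡ y) ⊎ (x ≡ z) ⊎ (y ≡ z))

-- The limit in (k, s) of a_i(n,k,s) is 1 exactly when the dyadic block B^n meets A,
-- and since A is infinite, infinitely many blocks above i do.  Choose M so that at
-- least 2^i of the n with i < n < M have B^n meeting A, and let C be the first 2^i
-- of them.  For s ≥ M the list of n with i < n < s extends the one for M, so once
-- the finitely many values a_i(n,k,s), i < n < M, have reached their limits the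
-- first 2^i entries of C_i(k,s) are already found below M and equal C.
module Submission where

open import Defs
open import Data.Nat using (ℕ; zero; suc; _+_; _∸_; _^_; _≤_; _<_; _⊔_; _≤′_; ≤′-refl; ≤′-step; z≤n; s≤s; _<?_)
open import Data.Nat.Properties
open import Data.Bool using (Bool; true; false; T; _∨_; if_then_else_)
open import Data.Bool.Properties using (T?; T-≡)
open import Data.Bool.ListAction using (any)
open import Data.List using (List; []; _∷_; _++_; _∷ʳ_; length; map; upTo; take; filterᵇ)
open import Data.List.Properties using (filter-++; filter-accept; length-++; length-take; map-++; upTo-∷ʳ; ++-assoc; ++-identityʳ)
open import Data.List.Membership.Propositional using (_∈_; lose)
open import Data.List.Membership.Propositional.Properties using (∈-map⁺; ∈-map⁻; ∈-upTo⁺)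
open import Data.List.Relation.Unary.All as All using (All; []; _∷_)
open import Data.List.Relation.Unary.Any.Properties using (any⁺)
open import Data.Product using (Σ; ∃; _×_; _,_; proj₁; proj₂)
open import Function using (Equivalence; _∘_)
open import Relation.Binary.PropositionalEquality using (_≡_; refl; sym; trans; cong; cong₂; subst; module ≡-Reasoning)
open import Relation.Nullary using (yes; no)

private
  variable
    X Y Z : Set

limLim-const : (v : X) → LimLim (λ _ _ → v) v
limLim-const v = 0 , λ _ _ → 0 , λ _ _ → refl

limLim-map₂ : {f : ℕ → ℕ → X} {g : ℕ → ℕ → Y} {v : X} {w : Y} (h : X → Y → Z) →
  LimLim f v → LimLim g w → LimLim (λ k s → h (f k s) (g k s)) (h v w)
limLim-map₂ h (K₁ , lim₁) (K₂ , lim₂) = K₁ ⊔ K₂ , λ k K<k →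
  let s₁ , eq₁ = lim₁ k (m⊔n<o⇒m<o _ _ K<k)
      s₂ , eq₂ = lim₂ k (m⊔n<o⇒n<o _ _ K<k)
  in s₁ ⊔ s₂ , λ s bound<s →
    cong₂ h (eq₁ s (m⊔n<o⇒m<o _ _ bound<s)) (eq₂ s (m⊔n<o⇒n<o _ _ bound<s))

limLim-transfer : {f : ℕ → ℕ → X} {g : ℕ → ℕ → Y} {v : X} {w : Y} (M : ℕ) →
  LimLim f v → (∀ k s → M ≤ s → f k s ≡ v → g k s ≡ w) → LimLim g w
limLim-transfer M (K , lim) f≡v⇒g≡w = K , λ k K<k →
  let sₖ , eq = lim k K<k
  in sₖ ⊔ M , λ s bound<s →
    f≡v⇒g≡w k s (<⇒≤ (m⊔n<o⇒n<o _ _ bound<s)) (eq s (m⊔n<o⇒m<o _ _ bound<s))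

limLim-any : {p : ℕ → ℕ → X → Bool} {q : X → Bool} {xs : List X} →
  All (λ x → LimLim (λ k s → p k s x) (q x)) xs →
  LimLim (λ k s → any (p k s) xs) (any q xs)
limLim-any []             = limLim-const false
limLim-any (lim-x ∷ lims) = limLim-map₂ _∨_ lim-x (limLim-any lims)

filterᵇ-∷ : (p : X → Bool) (x : X) (xs : List X) →
  filterᵇ p (x ∷ xs) ≡ (if p x then x ∷ filterᵇ p xs else filterᵇ p xs)
filterᵇ-∷ p x xs with p x
... | true  = refl
... | false = refl

limLim-filterᵇ : {p : ℕ → ℕ → X → Bool} {q : X → Bool} {xs : List X} →
  All (λ x → LimLim (λ k s → p k s x) (q x)) xs →
  LimLim (λ k s → filterᵇ (p k s) xs) (filterᵇ q xs)
limLim-filterᵇ [] = limLim-const []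
limLim-filterᵇ {p = p} {q} {x ∷ xs} (lim-x ∷ lims) =
  limLim-transfer 0 (limLim-map₂ (λ b r → if b then x ∷ r else r) lim-x (limLim-filterᵇ lims))
    λ k s _ eq → trans (filterᵇ-∷ (p k s) x xs) (trans eq (sym (filterᵇ-∷ q x xs)))

take-++ˡ : ∀ t (xs ys : List X) → t ≤ length xs → take t (xs ++ ys) ≡ take t xs
take-++ˡ zero    xs       ys _         = refl
take-++ˡ (suc t) (x ∷ xs) ys (s≤s t≤n) = cong (x ∷_) (take-++ˡ t xs ys t≤n)

upTo-prefix : ∀ {m n} → m ≤′ n → ∃ λ R → upTo n ≡ upTo m ++ R
upTo-prefix {m} ≤′-refl = [] , sym (++-identityʳ (upTo m))
upTo-prefix {m} (≤′-step {n} m≤′n) =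
  let R , eq = upTo-prefix m≤′n
  in R ∷ʳ n , (begin
    upTo (suc n)          ≡⟨ upTo-∷ʳ n ⟨
    upTo n ∷ʳ n           ≡⟨ cong (_∷ʳ n) eq ⟩
    (upTo m ++ R) ∷ʳ n    ≡⟨ ++-assoc (upTo m) R (n ∷ []) ⟩
    upTo m ++ R ∷ʳ n      ∎)
  where open ≡-Reasoning

between-prefix : ∀ i {M s} → M ≤ s → ∃ λ R → between i s ≡ between i M ++ R
between-prefix i {M} M≤s =
  let R , eq = upTo-prefix (≤⇒≤′ (∸-monoˡ-≤ (suc i) M≤s))
  in map (suc i +_) R , trans (cong (map (suc i +_)) eq) (map-++ (suc i +_) (upTo (M ∸ suc i)) R)

between-suc : ∀ {i n} → i < n → between i (suc n) ≡ between i n ++ n ∷ []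
between-suc {i} {n} i<n = begin
  map (suc i +_) (upTo (suc n ∸ suc i))          ≡⟨ cong (map (suc i +_) ∘ upTo) (+-∸-assoc 1 i<n) ⟩
  map (suc i +_) (upTo (suc d))                  ≡⟨ cong (map (suc i +_)) (upTo-∷ʳ d) ⟨
  map (suc i +_) (upTo d ∷ʳ d)                   ≡⟨ map-++ (suc i +_) (upTo d) (d ∷ []) ⟩
  map (suc i +_) (upTo d) ++ (suc i + d) ∷ []    ≡⟨ cong (λ m → map (suc i +_) (upTo d) ++ m ∷ []) (m+[n∸m]≡n i<n) ⟩
  map (suc i +_) (upTo d) ++ n ∷ []              ∎
  where
  open ≡-Reasoning
  d = n ∸ suc i

take-filterᵇ-between-stable : ∀ (p : ℕ → Bool) i t {M s} → M ≤ s →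
  t ≤ length (filterᵇ p (between i M)) →
  take t (filterᵇ p (between i s)) ≡ take t (filterᵇ p (between i M))
take-filterᵇ-between-stable p i t {M} {s} M≤s enough =
  let R , eq = between-prefix i M≤s
  in begin
    take t (filterᵇ p (between i s))                           ≡⟨ cong (take t ∘ filterᵇ p) eq ⟩
    take t (filterᵇ p (between i M ++ R))                      ≡⟨ cong (take t) (filter-++ (T? ∘ p) (between i M) R) ⟩
    take t (filterᵇ p (between i M) ++ filterᵇ p R)            ≡⟨ take-++ˡ t _ _ enough ⟩
    take t (filterᵇ p (between i M))                           ∎
  where open ≡-Reasoning

length-filterᵇ-++ : (p : X → Bool) (xs ys : List X) →
  length (filterᵇ p (xs ++ ys)) ≡ length (filterᵇ p xs) + length (filterᵇ p ys)
length-filterᵇ-++ p xs ys = trans (cong length (filter-++ (T? ∘ p) xs ys)) (length-++ (filterᵇ p xs))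

length-filterᵇ-between-mono : ∀ (p : ℕ → Bool) i {M s} → M ≤ s →
  length (filterᵇ p (between i M)) ≤ length (filterᵇ p (between i s))
length-filterᵇ-between-mono p i {M} {s} M≤s =
  let R , eq = between-prefix i M≤s
  in begin
    length (filterᵇ p (between i M))                                ≤⟨ m≤m+n _ _ ⟩
    length (filterᵇ p (between i M)) + length (filterᵇ p R)         ≡⟨ length-filterᵇ-++ p (between i M) R ⟨
    length (filterᵇ p (between i M ++ R))                           ≡⟨ cong (length ∘ filterᵇ p) eq ⟨
    length (filterᵇ p (between i s))                                ∎
  where open ≤-Reasoning

length-filterᵇ-between-suc : ∀ {p : ℕ → Bool} {i n} → i < n → T (p n) →
  length (filterᵇ p (between i (suc n))) ≡ suc (length (filterᵇ p (between i n)))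
length-filterᵇ-between-suc {p} {i} {n} i<n pn = begin
  length (filterᵇ p (between i (suc n)))                          ≡⟨ cong (length ∘ filterᵇ p) (between-suc i<n) ⟩
  length (filterᵇ p (between i n ++ n ∷ []))                      ≡⟨ length-filterᵇ-++ p (between i n) (n ∷ []) ⟩
  length (filterᵇ p (between i n)) + length (filterᵇ p (n ∷ []))  ≡⟨ cong (λ r → length (filterᵇ p (between i n)) + length r) (filter-accept (T? ∘ p) pn) ⟩
  length (filterᵇ p (between i n)) + 1                            ≡⟨ +-comm _ 1 ⟩
  suc (length (filterᵇ p (between i n)))                          ∎
  where open ≡-Reasoning

unbounded⇒filterᵇ-between-long : (p : ℕ → Bool) → (∀ N → ∃ λ n → N < n × T (p n)) →
  ∀ i t → ∃ λ M → t ≤ length (filterᵇ p (between i M))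
unbounded⇒filterᵇ-between-long p unbounded i zero    = 0 , z≤n
unbounded⇒filterᵇ-between-long p unbounded i (suc t) =
  let M , enough     = unbounded⇒filterᵇ-between-long p unbounded i t
      n , M+i<n , pn = unbounded (M + i)
      M≤n            = ≤-trans (m≤m+n M i) (<⇒≤ M+i<n)
      i<n            = ≤-<-trans (m≤n+m i M) M+i<n
  in suc n , subst (suc t ≤_) (sym (length-filterᵇ-between-suc i<n pn))
                   (s≤s (≤-trans enough (length-filterᵇ-between-mono p i M≤n)))

InB-suc-exists : ∀ x → ∃ λ n → InB n (suc x)
InB-suc-exists zero    = 0 , ≤-refl , ≤-refl
InB-suc-exists (suc x) with InB-suc-exists x
... | n , lo , hi with suc (suc x) <? 2 ^ suc n
...   | yes below = n , m≤n⇒m≤1+n lo , below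
...   | no  ¬below = suc n , ≮⇒≥ ¬below , ≤-<-trans hi (^-monoʳ-< 2 (s≤s (s≤s z≤n)) (n<1+n (suc n)))

InB⇒∈Bset : ∀ {n x} → InB n x → x ∈ Bset n
InB⇒∈Bset {n} {x} (lo , hi) =
  subst (_∈ Bset n) (m+[n∸m]≡n lo) (∈-map⁺ (2 ^ n +_) (∈-upTo⁺ offset<))
  where
  offset< : x ∸ 2 ^ n < 2 ^ n
  offset< = m<n+o⇒m∸n<o x (2 ^ n) {{m^n≢0 2 n}} (subst (x <_) (cong (2 ^ n +_) (+-identityʳ (2 ^ n))) hi)

∈Bset⇒positive : ∀ {n x} → x ∈ Bset n → 1 ≤ x
∈Bset⇒positive {n} x∈ with ∈-map⁻ (2 ^ n +_) x∈
... | y , _ , refl = ≤-trans (m^n>0 2 n) (m≤m+n (2 ^ n) y)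

occupied : (ℕ → Bool) → ℕ → Bool
occupied χ n = any χ (Bset n)

limLim-aFun : {A : Approx} {χ : ℕ → Bool} → ((x : ℕ) → 1 ≤ x → LimLim (A x) (χ x)) →
  ∀ n → LimLim (aFun A n) (occupied χ n)
limLim-aFun lim n = limLim-any (All.tabulate (λ {x} x∈ → lim x (∈Bset⇒positive {n} x∈)))

infinite⇒occupied-unbounded : {χ : ℕ → Bool} → Infinite χ → ∀ N → ∃ λ n → N < n × T (occupied χ n)
infinite⇒occupied-unbounded {χ} inf N with inf (2 ^ suc N)
... | suc x , big , χx =
  let n , lo , hi = InB-suc-exists x
      N<n = ≰⇒> λ n≤N → <-irrefl refl (<-trans big (<-≤-trans hi (^-monoʳ-≤ 2 (s≤s n≤N))))
  in n , N<n , any⁺ χ (lose (InB⇒∈Bset {n} (lo , hi)) (Equivalence.from T-≡ χx))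

mainTheorem15 : (i : ℕ) (A : Approx) (χ : ℕ → Bool) →
    ((x : ℕ) → 1 ≤ x → LimLim (A x) (χ x)) →
    Infinite χ → WeakApart χ →
    Σ (List ℕ) λ C → length C ≡ 2 ^ i × LimLim (Cfun i A) C
mainTheorem15 i A χ lim inf _ = C , length-C , limLim-transfer M lim-prefix C-stable
  where
  t : ℕ
  t = 2 ^ i

  long : ∃ λ M → t ≤ length (filterᵇ (occupied χ) (between i M))
  long = unbounded⇒filterᵇ-between-long (occupied χ) (infinite⇒occupied-unbounded inf) i t

  M : ℕ
  M = proj₁ long

  L C : List ℕ
  L = filterᵇ (occupied χ) (between i M)
  C = take t L

  length-C : length C ≡ t
  length-C = trans (length-take t L) (m≤n⇒m⊓n≡m (proj₂ long))

  lim-prefix : LimLim (λ k s → filterᵇ (λ n → aFun A n k s) (between i M)) L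
  lim-prefix = limLim-filterᵇ (All.tabulate {xs = between i M} (λ {n} _ → limLim-aFun lim n))

  C-stable : ∀ k s → M ≤ s → filterᵇ (λ n → aFun A n k s) (between i M) ≡ L → Cfun i A k s ≡ C
  C-stable k s M≤s eq =
    trans (take-filterᵇ-between-stable (λ n → aFun A n k s) i t M≤s (subst (λ xs → t ≤ length xs) (sym eq) (proj₂ long)))
          (cong (take t) eq)
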